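{- Every Any Fit algorithm is absolutely $3$-competitive for Black and White Bin Packing: on every input sequence $L$ it uses at most $3\cdot\mathrm{OPT}(L)$ bins.
   Context: Black and White Bin Packing: items arrive as a sequence; each item has a size in $[0,1]$ and a color that is either black or white. A packing places items into unit-capacity bins, items in a bin ordered by arrival; it is valid if each bin has total size at most $1$ and the colors of consecutive items in each bin alternate (no two consecutive items in a bin have the same color). $\mathrm{OPT}(L)$ is the minimum number of bins in a valid packing of $L$ without reordering. An Any Fit algorithm is an online algorithm that packs each incoming item into some already existing bin whenever there is a bin into which it can be validly added (the choice among such bins is arbitrary and depends on the algorithm), and opens a new bin only when there is no such bin.
   Formalization: The item sizes are rational numbers in $[0,1]$. -}

module Defs where

open import Data.Nat using (ℕ)
open import Data.Rational using (ℚ; 0ℚ; 1ℚ; _+_; _≤_)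
open import Data.List using (List; []; _∷_; _++_; [_]; length; lookup; map; filter; foldr; allFin)
open import Data.List.Relation.Unary.All using (All)
open import Data.Fin using (Fin; zero; suc)
import Data.Fin as Fin
open import Data.Maybe using (Maybe; just; nothing)
open import Data.Product using (Σ; _×_)
open import Data.Unit using (⊤)
open import Relation.Nullary using (¬_)
open import Relation.Binary.PropositionalEquality using (_≡_; _≢_)

data Color : Set where
  black white : Color

record Item : Set where
  constructor item
  field
    size  : ℚ
    color : Color
open Item public

InUnit : Item → Set
InUnit x = (0ℚ ≤ size x) × (size x ≤ 1ℚ)

-- Bins: a bin is the list of its items in order of arrival

Bin : Set
Bin = List Item

load : Bin → ℚ
load = foldr (λ x s → size x + s) 0ℚ

Alternating : Bin → Set
Alternating []            = ⊤
Alternating (x ∷ [])      = ⊤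
Alternating (x ∷ y ∷ ys)  = (color x ≢ color y) × Alternating (y ∷ ys)

ValidBin : Bin → Set
ValidBin b = (load b ≤ 1ℚ) × Alternating b

-- Offline packings (no reordering): each item is assigned a bin among k
-- bins; the contents of a bin are its items in arrival order.

binContents : (L : List Item) {k : ℕ} → (Fin (length L) → Fin k) → Fin k → Bin
binContents L a b = map (lookup L) (filter (λ i → a i Fin.≟ b) (allFin (length L)))

ValidPacking : (L : List Item) (k : ℕ) → (Fin (length L) → Fin k) → Set
ValidPacking L k a = (b : Fin k) → ValidBin (binContents L a b)

-- L can be validly packed into k bins, i.e. OPT(L) ≤ k
Packable : List Item → ℕ → Set
Packable L k = Σ (Fin (length L) → Fin k) (ValidPacking L k)

ColourOK : Bin → Item → Set
ColourOK []            x = ⊤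
ColourOK (y ∷ [])      x = color y ≢ color x
ColourOK (y ∷ z ∷ ys)  x = ColourOK (z ∷ ys) x

Fits : Bin → Item → Set
Fits b x = (load b + size x ≤ 1ℚ) × ColourOK b x

-- An online algorithm: given the items seen so far, the current bins
-- and the new item, it chooses an existing bin (just i) or opens a new
-- bin (nothing).
record AnyFit : Set where
  field
    choose   : (history : List Item) (bins : List Bin) (x : Item) → Maybe (Fin (length bins))
    sound    : ∀ h bs x i → choose h bs x ≡ just i → Fits (lookup bs i) x
    complete : ∀ h bs x → choose h bs x ≡ nothing → ∀ i → ¬ Fits (lookup bs i) x
open AnyFit public

addTo : (bs : List Bin) → Fin (length bs) → Item → List Bin
addTo (b ∷ bs) zero    x = (b ++ [ x ]) ∷ bs
addTo (b ∷ bs) (suc i) x = b ∷ addTo bs i x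

place : (bs : List Bin) → Maybe (Fin (length bs)) → Item → List Bin
place bs (just i) x = addTo bs i x
place bs nothing  x = bs ++ [ [ x ] ]

runFrom : AnyFit → (history : List Item) → List Bin → List Item → List Bin
runFrom A h bs []       = bs
runFrom A h bs (x ∷ xs) = runFrom A (h ++ [ x ]) (place bs (choose A h bs x) x) xs

run : AnyFit → List Item → List Bin
run A L = runFrom A [] [] L

-- Let S be the total size of L and D the number of bins used by the greedy packing that ignores
-- sizes and puts each item on a bin whose top item has the other colour whenever there is one.
-- Both are lower bounds for OPT: bins have capacity 1, and in any valid packing the number of
-- bins topped by colour c never drops below the greedy count of such bins.
-- Any Fit uses at most D + 2S bins. Fix θ ≤ 1/2. Along the run the number of bins of load at
-- most θ never exceeds D plus the number of bins of load above 1 − θ, because a small item opens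
-- a new bin only if every bin topped by the other colour would overflow. A list of loads with
-- this property for every θ has length at most D + 2S: remove its minimum m, together with some
-- y such that m + y > 1 if there is one (two bins of total load above 1), and otherwise alone,
-- which the property at θ = m pays for with one unit of D.

module Submission where

open import Defs
open import Data.Nat using (ℕ; _≤_; _*_)
open import Data.List using (List; length)
open import Data.List.Relation.Unary.All using (All)

open import Algebra.Bundles using (CommutativeMonoid)
import Algebra.Properties.CommutativeMonoid.Sum as CommutativeMonoidSum
import Algebra.Properties.Monoid.Mult as MonoidMult
import Algebra.Solver.CommutativeMonoid as CommutativeMonoidSolver
open import Data.Bool using (Bool; true; false; not; _∧_; T)
open import Data.Bool.Properties using (T-∧)
open import Data.Empty using (⊥-elim)
open import Data.Fin using (Fin; zero; suc)
import Data.Fin as Fin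
open import Data.Fin.Properties using (punchInᵢ≢i)
open import Data.List using ([]; _∷_; _++_; [_]; map; lookup; filter; foldr; foldl; tabulate; removeAt; last)
open import Data.List.Properties using (++-assoc; ++-identityʳ; foldl-∷ʳ; map-∘; tabulate-lookup; length-map)
open import Data.List.Relation.Binary.Permutation.Propositional
  using (_↭_; ↭-refl; ↭-sym; ↭-trans; prep; swap; ↭⇒↭ₛ)
open import Data.List.Relation.Binary.Permutation.Propositional.Properties
  using (map⁺; ↭-length; All-resp-↭; ∷↭∷ʳ)
open import Data.List.Relation.Binary.Permutation.Setoid.Properties using (foldr-commMonoid)
open import Data.List.Relation.Unary.All using ([]; _∷_; all?)
import Data.List.Relation.Unary.All as All
open import Data.List.Relation.Unary.All.Properties using (tabulate⁺; ¬All⇒Any¬) renaming (map⁺ to All-map⁺)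
open import Data.List.Relation.Unary.Any using (Any; here; there)
open import Data.Maybe using (Maybe; just; nothing)
import Data.Maybe as Maybe
open import Data.Maybe.Properties using (just-injective)
open import Data.Nat using (zero; suc; _+_; _∸_; _<_; z≤n; s≤s)
open import Data.Nat.Induction using (<-wellFounded)
open import Data.Nat.ListAction using (sum)
open import Data.Nat.ListAction.Properties using (sum-↭)
import Data.Nat.Properties as ℕ
open import Data.Product using (Σ-syntax; ∃₂; _×_; _,_; proj₁; proj₂)
open import Data.Rational using (ℚ; 0ℚ; 1ℚ)
import Data.Rational as ℚ
import Data.Rational.Properties as ℚ
open import Data.Unit using (⊤; tt)
open import Data.Vec.Functional using (Vector; updateAt)
open import Data.Vec.Functional.Properties using (updateAt-updates; updateAt-minimal)
open import Function using (_∘_; Equivalence)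
open import Induction.WellFounded using (Acc; acc)
open import Relation.Binary.PropositionalEquality
  using (_≡_; _≢_; refl; sym; trans; cong; cong₂; subst; subst₂; setoid; module ≡-Reasoning)
open import Relation.Nullary using (¬_; yes; no; isYes)
open import Relation.Nullary.Decidable using (toWitness; fromWitness)

𝟙 : Bool → ℕ
𝟙 true  = 1
𝟙 false = 0

𝟙-T : ∀ {p} → T p → 𝟙 p ≡ 1
𝟙-T {true} _ = refl

𝟙-¬T : ∀ {p} → ¬ T p → 𝟙 p ≡ 0
𝟙-¬T {true}  ¬p = ⊥-elim (¬p tt)
𝟙-¬T {false} _  = refl

𝟙≤1 : ∀ p → 𝟙 p ≤ 1
𝟙≤1 true  = ℕ.≤-refl
𝟙≤1 false = z≤n

𝟙-mono : ∀ {p q} → (T p → T q) → 𝟙 p ≤ 𝟙 q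
𝟙-mono {true}  {true}  _   = ℕ.≤-refl
𝟙-mono {true}  {false} p⇒q = ⊥-elim (p⇒q tt)
𝟙-mono {false}         _   = z≤n

𝟙-not+𝟙 : ∀ {p q} → (T q → T p) → 𝟙 (not p) + 𝟙 q ≤ 1
𝟙-not+𝟙 {true}  {q}     _   = 𝟙≤1 q
𝟙-not+𝟙 {false} {true}  q⇒p = ⊥-elim (q⇒p tt)
𝟙-not+𝟙 {false} {false} _   = ℕ.≤-refl

count : {A : Set} → (A → Bool) → List A → ℕ
count p xs = sum (map (𝟙 ∘ p) xs)

module _ {A : Set} where

  count-↭ : ∀ {p : A → Bool} {xs ys} → xs ↭ ys → count p xs ≡ count p ys
  count-↭ {p} xs↭ys = sum-↭ (map⁺ (𝟙 ∘ p) xs↭ys)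

  count-mono : ∀ (p q : A → Bool) {xs} → All (λ x → T (p x) → T (q x)) xs → count p xs ≤ count q xs
  count-mono p q []           = z≤n
  count-mono p q (p⇒q ∷ p⇒qs) = ℕ.+-mono-≤ (𝟙-mono p⇒q) (count-mono p q p⇒qs)

  count-zero : ∀ (p : A → Bool) {xs} → All (λ x → ¬ T (p x)) xs → count p xs ≡ 0
  count-zero p []         = refl
  count-zero p (¬p ∷ ¬ps) = cong₂ _+_ (𝟙-¬T ¬p) (count-zero p ¬ps)

  count-map : ∀ {B : Set} (p : A → Bool) (f : B → A) xs → count p (map f xs) ≡ count (p ∘ f) xs
  count-map p f xs = cong sum (sym (map-∘ xs))

suc≤+⇒≤∸1+ : ∀ {a} n u → suc a ≤ n + u → a ≤ (n ∸ 1) + u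
suc≤+⇒≤∸1+ zero    u a<u      = ℕ.<⇒≤ a<u
suc≤+⇒≤∸1+ (suc n) u (s≤s a≤) = a≤

+≤∸1+suc : ∀ n u → n + u ≤ (n ∸ 1) + suc u
+≤∸1+suc n u = subst (n + u ≤_) (sym (ℕ.+-suc (n ∸ 1) u)) (ℕ.+-monoˡ-≤ u (ℕ.m≤n+m∸n n 1))

module ℚ-Solver = CommutativeMonoidSolver ℚ.+-0-commutativeMonoid

nonneg-+ : ∀ {p q} → 0ℚ ℚ.≤ p → 0ℚ ℚ.≤ q → 0ℚ ℚ.≤ p ℚ.+ q
nonneg-+ {p} {q} 0≤p 0≤q = subst (ℚ._≤ p ℚ.+ q) (ℚ.+-identityʳ 0ℚ) (ℚ.+-mono-≤ 0≤p 0≤q)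

≤-+-nonneg : ∀ p {q} → 0ℚ ℚ.≤ q → p ℚ.≤ q ℚ.+ p
≤-+-nonneg p {q} 0≤q = subst (ℚ._≤ q ℚ.+ p) (ℚ.+-identityˡ p) (ℚ.+-monoˡ-≤ p 0≤q)

<⇒≱ : ∀ {p q} → p ℚ.< q → ¬ q ℚ.≤ p
<⇒≱ p<q q≤p = ℚ.<-irrefl refl (ℚ.<-≤-trans p<q q≤p)

doubles≤1⇒+≤1 : ∀ x y → x ℚ.+ x ℚ.≤ 1ℚ → y ℚ.+ y ℚ.≤ 1ℚ → x ℚ.+ y ℚ.≤ 1ℚ
doubles≤1⇒+≤1 x y 2x≤1 2y≤1 with (x ℚ.+ y) ℚ.≤? 1ℚ
... | yes x+y≤1 = x+y≤1
... | no  x+y≰1 = ⊥-elim (<⇒≱ (ℚ.+-mono-< 1<x+y 1<x+y) (subst (ℚ._≤ 1ℚ ℚ.+ 1ℚ) interchange (ℚ.+-mono-≤ 2x≤1 2y≤1)))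
  where
  open ℚ-Solver
  1<x+y : 1ℚ ℚ.< x ℚ.+ y
  1<x+y = ℚ.≰⇒> x+y≰1
  interchange : (x ℚ.+ x) ℚ.+ (y ℚ.+ y) ≡ (x ℚ.+ y) ℚ.+ (x ℚ.+ y)
  interchange = solve 2 (λ x y → (x ⊕ x) ⊕ (y ⊕ y) ⊜ (x ⊕ y) ⊕ (x ⊕ y)) refl x y

module ℚ-Mult = MonoidMult ℚ.+-0-monoid

fromℕ : ℕ → ℚ
fromℕ n = n ℚ-Mult.× 1ℚ

fromℕ-nonneg : ∀ n → 0ℚ ℚ.≤ fromℕ n
fromℕ-nonneg zero    = ℚ.≤-refl
fromℕ-nonneg (suc n) = nonneg-+ (ℚ.<⇒≤ (ℚ.positive⁻¹ 1ℚ)) (fromℕ-nonneg n)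

fromℕ-mono-≤ : ∀ {m n} → m ≤ n → fromℕ m ℚ.≤ fromℕ n
fromℕ-mono-≤ {n = n} z≤n = fromℕ-nonneg n
fromℕ-mono-≤ (s≤s m≤n)   = ℚ.+-monoʳ-≤ 1ℚ (fromℕ-mono-≤ m≤n)

fromℕ-<-suc : ∀ n → fromℕ n ℚ.< fromℕ (suc n)
fromℕ-<-suc n = subst (ℚ._< fromℕ (suc n)) (ℚ.+-identityˡ (fromℕ n)) (ℚ.+-monoˡ-< (fromℕ n) (ℚ.positive⁻¹ 1ℚ))

fromℕ-cancel-≤ : ∀ {m n} → fromℕ m ℚ.≤ fromℕ n → m ≤ n
fromℕ-cancel-≤ {m} {n} fm≤fn with m ℕ.≤? n
... | yes m≤n = m≤n
... | no  m≰n = ⊥-elim (<⇒≱ (fromℕ-<-suc n) (ℚ.≤-trans (fromℕ-mono-≤ (ℕ.≰⇒> m≰n)) fm≤fn))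

fromℕ-3* : ∀ k → fromℕ k ℚ.+ (fromℕ k ℚ.+ fromℕ k) ≡ fromℕ (3 * k)
fromℕ-3* k = begin
  fromℕ k ℚ.+ (fromℕ k ℚ.+ fromℕ k)           ≡⟨ cong (λ z → fromℕ k ℚ.+ (fromℕ k ℚ.+ z)) (cong fromℕ (ℕ.+-identityʳ k)) ⟨
  fromℕ k ℚ.+ (fromℕ k ℚ.+ fromℕ (k + 0))     ≡⟨ cong (fromℕ k ℚ.+_) (ℚ-Mult.×-homo-+ 1ℚ k (k + 0)) ⟨
  fromℕ k ℚ.+ fromℕ (k + (k + 0))             ≡⟨ ℚ-Mult.×-homo-+ 1ℚ k (k + (k + 0)) ⟨
  fromℕ (3 * k)                               ∎
  where open ≡-Reasoning

sumℚ : List ℚ → ℚ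
sumℚ = foldr ℚ._+_ 0ℚ

sumℚ-↭ : ∀ {xs ys} → xs ↭ ys → sumℚ xs ≡ sumℚ ys
sumℚ-↭ xs↭ys = foldr-commMonoid (setoid ℚ) ℚ.+-0-isCommutativeMonoid (↭⇒↭ₛ xs↭ys)

module _ {c ℓ} (M : CommutativeMonoid c ℓ) where
  open CommutativeMonoid M using (Carrier; _≈_; _∙_; ∙-congˡ)
    renaming (trans to ≈-trans; reflexive to ≈-reflexive)
  open CommutativeMonoidSum M using (sum-remove; sum-cong-≗)
    renaming (sum to ∑)

  sum-split-at : ∀ {n} {f g : Vector Carrier n} (i : Fin n) → (∀ j → j ≢ i → f j ≡ g j) →
               Σ[ r ∈ Carrier ] (∑ f ≈ f i ∙ r) × (∑ g ≈ g i ∙ r)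
  sum-split-at {suc n} {f} {g} i agree =
    ∑ (Data.Vec.Functional.removeAt g i) ,
    ≈-trans (sum-remove f) (∙-congˡ (≈-reflexive (sum-cong-≗ (λ j → agree _ (punchInᵢ≢i i j))))) ,
    sum-remove g

module ℕΣ = CommutativeMonoidSum ℕ.+-0-commutativeMonoid
module ℚΣ = CommutativeMonoidSum ℚ.+-0-commutativeMonoid

ℕΣ-≤ : ∀ {n} (f : Vector ℕ n) → (∀ j → f j ≤ 1) → ℕΣ.sum f ≤ n
ℕΣ-≤ {zero}  f _    = z≤n
ℕΣ-≤ {suc n} f f≤1 = ℕ.+-mono-≤ (f≤1 zero) (ℕΣ-≤ (f ∘ suc) (f≤1 ∘ suc))

ℚΣ-≤ : ∀ {n} (f : Vector ℚ n) → (∀ j → f j ℚ.≤ 1ℚ) → ℚΣ.sum f ℚ.≤ fromℕ n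
ℚΣ-≤ {zero}  f _    = ℚ.≤-refl
ℚΣ-≤ {suc n} f f≤1 = ℚ.+-mono-≤ (f≤1 zero) (ℚΣ-≤ (f ∘ suc) (f≤1 ∘ suc))

opposite : Color → Color
opposite black = white
opposite white = black

opposite-involutive : ∀ c → opposite (opposite c) ≡ c
opposite-involutive black = refl
opposite-involutive white = refl

opposite-≢ : ∀ c → opposite c ≢ c
opposite-≢ black ()
opposite-≢ white ()

≢⇒≡opposite : ∀ {c d} → d ≢ c → d ≡ opposite c
≢⇒≡opposite {black} {black} d≢c = ⊥-elim (d≢c refl)
≢⇒≡opposite {black} {white} _   = refl
≢⇒≡opposite {white} {black} _   = refl
≢⇒≡opposite {white} {white} d≢c = ⊥-elim (d≢c refl)

¬≢⇒≡ : ∀ {c d : Color} → ¬ c ≢ d → c ≡ d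
¬≢⇒≡ {black} {black} _ = refl
¬≢⇒≡ {black} {white} h = ⊥-elim (h (λ ()))
¬≢⇒≡ {white} {black} h = ⊥-elim (h (λ ()))
¬≢⇒≡ {white} {white} _ = refl

by-colour : (P : Color → Set) (c : Color) → P c → P (opposite c) → ∀ d → P d
by-colour P black p q black = p
by-colour P black p q white = q
by-colour P white p q black = q
by-colour P white p q white = p

hasColour : Color → Maybe Color → Bool
hasColour black (just black) = true
hasColour white (just white) = true
hasColour _     _            = false

hasColour-just : ∀ c → T (hasColour c (just c))
hasColour-just black = tt
hasColour-just white = tt

hasColour-≢ : ∀ {c m} → m ≢ just c → ¬ T (hasColour c m)
hasColour-≢ {black} {just black} m≢ _ = m≢ refl
hasColour-≢ {white} {just white} m≢ _ = m≢ refl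

hasColour-exclusive : ∀ m → 𝟙 (hasColour black m) + 𝟙 (hasColour white m) ≤ 1
hasColour-exclusive nothing      = z≤n
hasColour-exclusive (just black) = ℕ.≤-refl
hasColour-exclusive (just white) = ℕ.≤-refl

top : Bin → Maybe Color
top b = Maybe.map color (last b)

isTop : Color → Bin → Bool
isTop c b = hasColour c (top b)

isTop-just : ∀ {c} b → top b ≡ just c → T (isTop c b)
isTop-just {c} _ tb = subst (T ∘ hasColour c) (sym tb) (hasColour-just c)

isTop-≢ : ∀ {c d} b → top b ≡ just d → d ≢ c → ¬ T (isTop c b)
isTop-≢ {c} _ tb d≢c = subst (¬_ ∘ T ∘ hasColour c) (sym tb) (hasColour-≢ (d≢c ∘ just-injective))

top-∷ʳ : ∀ b x → top (b ++ [ x ]) ≡ just (color x)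
top-∷ʳ []           x = refl
top-∷ʳ (y ∷ [])     x = refl
top-∷ʳ (y ∷ z ∷ zs) x = top-∷ʳ (z ∷ zs) x

ColourOK⇒top : ∀ b x → b ≢ [] → ColourOK b x → top b ≡ just (opposite (color x))
ColourOK⇒top []           x b≢[] _  = ⊥-elim (b≢[] refl)
ColourOK⇒top (y ∷ [])     x _    ok = cong just (≢⇒≡opposite ok)
ColourOK⇒top (y ∷ z ∷ zs) x _    ok = ColourOK⇒top (z ∷ zs) x (λ ()) ok

¬ColourOK⇒top : ∀ b x → ¬ ColourOK b x → top b ≡ just (color x)
¬ColourOK⇒top []           x ¬ok = ⊥-elim (¬ok tt)
¬ColourOK⇒top (y ∷ [])     x ¬ok = cong just (¬≢⇒≡ ¬ok)
¬ColourOK⇒top (y ∷ z ∷ zs) x ¬ok = ¬ColourOK⇒top (z ∷ zs) x ¬ok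

top≢⇒ColourOK : ∀ b x → top b ≢ just (color x) → ColourOK b x
top≢⇒ColourOK []           x _  = tt
top≢⇒ColourOK (y ∷ [])     x t≢ = t≢ ∘ cong just
top≢⇒ColourOK (y ∷ z ∷ zs) x t≢ = top≢⇒ColourOK (z ∷ zs) x t≢

-- t c counts the bins with top colour c in the greedy packing that ignores sizes.
Tokens : Set
Tokens = Color → ℕ

push : Color → Tokens → Tokens
push black t black = suc (t black)
push black t white = t white ∸ 1
push white t black = t black ∸ 1
push white t white = suc (t white)

push-same : ∀ c t → push c t c ≡ suc (t c)
push-same black t = refl
push-same white t = refl

push-opposite : ∀ c t → push c t (opposite c) ≡ t (opposite c) ∸ 1
push-opposite black t = refl
push-opposite white t = refl

total : Tokens → ℕ
total t = t black + t white

total-by : ∀ c t → total t ≡ t c + t (opposite c)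
total-by black t = refl
total-by white t = ℕ.+-comm (t black) (t white)

total-push : ∀ c t → total (push c t) ≡ suc (t c) + (t (opposite c) ∸ 1)
total-push c t = trans (total-by c (push c t)) (cong₂ _+_ (push-same c t) (push-opposite c t))

total≤total-push : ∀ c t → total t ≤ total (push c t)
total≤total-push c t = begin
  total t                                 ≡⟨ total-by c t ⟩
  t c + t (opposite c)                    ≤⟨ ℕ.+-monoʳ-≤ (t c) (ℕ.m≤n+m∸n (t (opposite c)) 1) ⟩
  t c + suc (t (opposite c) ∸ 1)          ≡⟨ ℕ.+-suc (t c) _ ⟩
  suc (t c) + (t (opposite c) ∸ 1)        ≡⟨ total-push c t ⟨
  total (push c t)                        ∎
  where open ℕ.≤-Reasoning

suc≤total-push : ∀ c t → suc (t c) ≤ total (push c t)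
suc≤total-push c t = subst (suc (t c) ≤_) (sym (total-push c t)) (ℕ.m≤m+n (suc (t c)) _)

tokensFrom : Tokens → List Item → Tokens
tokensFrom = foldl (λ t x → push (color x) t)

tokens : List Item → Tokens
tokens = tokensFrom (λ _ → 0)

tokens-∷ʳ : ∀ h x → tokens (h ++ [ x ]) ≡ push (color x) (tokens h)
tokens-∷ʳ h x = foldl-∷ʳ (λ t y → push (color y) t) (λ _ → 0) x h

-- Lower bounds on the optimum

Continues : Maybe Color → Bin → Set
Continues (just c) (y ∷ _) = c ≢ color y
Continues _        _       = ⊤

Alternating-tail : ∀ x b → Alternating (x ∷ b) → Alternating b
Alternating-tail x []      _       = tt
Alternating-tail x (y ∷ b) (_ , a) = a

Alternating⇒Continues : ∀ x b → Alternating (x ∷ b) → Continues (just (color x)) b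
Alternating⇒Continues x []      _        = tt
Alternating⇒Continues x (y ∷ b) (x≢y , _) = x≢y

module _ (x : Item) (L : List Item) {k} (a : Fin (suc (length L)) → Fin k) (j : Fin k) where

  private
    drop-first : ∀ {m} (f : Fin m → Fin (length L)) →
      map (lookup (x ∷ L)) (filter (λ i → a i Fin.≟ j) (tabulate (suc ∘ f))) ≡
      map (lookup L) (filter (λ i → a (suc i) Fin.≟ j) (tabulate f))
    drop-first {zero}  f = refl
    drop-first {suc m} f with a (suc (f zero)) Fin.≟ j
    ... | yes _ = cong (lookup L (f zero) ∷_) (drop-first (f ∘ suc))
    ... | no  _ = drop-first (f ∘ suc)

  binContents-hit : a zero ≡ j → binContents (x ∷ L) a j ≡ x ∷ binContents L (a ∘ suc) j
  binContents-hit a₀≡j with a zero Fin.≟ j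
  ... | yes _    = cong (x ∷_) (drop-first (λ i → i))
  ... | no  a₀≢j = ⊥-elim (a₀≢j a₀≡j)

  binContents-miss : a zero ≢ j → binContents (x ∷ L) a j ≡ binContents L (a ∘ suc) j
  binContents-miss a₀≢j with a zero Fin.≟ j
  ... | yes a₀≡j = ⊥-elim (a₀≢j a₀≡j)
  ... | no  _    = drop-first (λ i → i)

binContents-load : ∀ L {k} (a : Fin (length L) → Fin k) → ℚΣ.sum (λ j → load (binContents L a j)) ≡ load L
binContents-load []      {k} a = ℚΣ.sum-replicate-zero k
binContents-load (x ∷ L) {k} a = begin
  ℚΣ.sum f                         ≡⟨ proj₁ (proj₂ split) ⟩
  f (a zero) ℚ.+ r                 ≡⟨ cong (λ b → load b ℚ.+ r) (binContents-hit x L a (a zero) refl) ⟩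
  (size x ℚ.+ g (a zero)) ℚ.+ r    ≡⟨ ℚ.+-assoc (size x) (g (a zero)) r ⟩
  size x ℚ.+ (g (a zero) ℚ.+ r)    ≡⟨ cong (size x ℚ.+_) (proj₂ (proj₂ split)) ⟨
  size x ℚ.+ ℚΣ.sum g              ≡⟨ cong (size x ℚ.+_) (binContents-load L (a ∘ suc)) ⟩
  size x ℚ.+ load L                ∎
  where
  open ≡-Reasoning
  f g : Vector ℚ k
  f j = load (binContents (x ∷ L) a j)
  g j = load (binContents L (a ∘ suc) j)
  split : Σ[ r ∈ ℚ ] (ℚΣ.sum f ≡ f (a zero) ℚ.+ r) × (ℚΣ.sum g ≡ g (a zero) ℚ.+ r)
  split = sum-split-at ℚ.+-0-commutativeMonoid (a zero)
            (λ j j≢a₀ → cong load (binContents-miss x L a j (j≢a₀ ∘ sym)))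
  r : ℚ
  r = proj₁ split

Packable⇒load≤ : ∀ L k → Packable L k → load L ℚ.≤ fromℕ k
Packable⇒load≤ L k (a , valid) = subst (ℚ._≤ fromℕ k) (binContents-load L a) (ℚΣ-≤ _ (proj₁ ∘ valid))

#top : ∀ {k} → Color → Vector (Maybe Color) k → ℕ
#top c tops = ℕΣ.sum (λ j → 𝟙 (hasColour c (tops j)))

#top-update : ∀ {k} (tops : Vector (Maybe Color) k) j c d → Σ[ r ∈ ℕ ]
  (#top d (updateAt tops j (λ _ → just c)) ≡ 𝟙 (hasColour d (just c)) + r) × (#top d tops ≡ 𝟙 (hasColour d (tops j)) + r)
#top-update tops j c d with sum-split-at ℕ.+-0-commutativeMonoid
  {f = λ i → 𝟙 (hasColour d (updateAt tops j (λ _ → just c) i))} {λ i → 𝟙 (hasColour d (tops i))} j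
  (λ i i≢j → cong (𝟙 ∘ hasColour d) (updateAt-minimal i j tops i≢j))
... | r , updated , original = r , trans updated (cong (λ m → 𝟙 (hasColour d m) + r) (updateAt-updates j tops)) , original

#top-set-same : ∀ {k} (tops : Vector (Maybe Color) k) j c → tops j ≢ just c →
                #top c (updateAt tops j (λ _ → just c)) ≡ suc (#top c tops)
#top-set-same tops j c top≢c with #top-update tops j c c
... | r , updated , original = begin
  #top c (updateAt tops j (λ _ → just c))   ≡⟨ updated ⟩
  𝟙 (hasColour c (just c)) + r              ≡⟨ cong (_+ r) (𝟙-T (hasColour-just c)) ⟩
  suc r                                     ≡⟨ cong (λ n → suc (n + r)) (𝟙-¬T (hasColour-≢ top≢c)) ⟨
  suc (𝟙 (hasColour c (tops j)) + r)        ≡⟨ cong suc original ⟨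
  suc (#top c tops)                         ∎
  where open ≡-Reasoning

#top-set-opposite : ∀ {k} (tops : Vector (Maybe Color) k) j c →
                    #top (opposite c) tops ∸ 1 ≤ #top (opposite c) (updateAt tops j (λ _ → just c))
#top-set-opposite tops j c with #top-update tops j c (opposite c)
... | r , updated , original = begin
  #top (opposite c) tops ∸ 1                      ≡⟨ cong (_∸ 1) original ⟩
  (𝟙 (hasColour (opposite c) (tops j)) + r) ∸ 1   ≤⟨ ℕ.∸-monoˡ-≤ 1
                                                       (ℕ.+-monoˡ-≤ r (𝟙≤1 (hasColour (opposite c) (tops j)))) ⟩
  r                                               ≡⟨ cong (_+ r) (𝟙-¬T (hasColour-≢ (opposite-≢ c ∘ sym ∘ just-injective))) ⟨
  𝟙 (hasColour (opposite c) (just c)) + r         ≡⟨ updated ⟨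
  #top (opposite c) (updateAt tops j (λ _ → just c)) ∎
  where open ℕ.≤-Reasoning

-- tops j is the top colour of bin j after the items preceding L have been packed.
tokensFrom≤bins : ∀ L {k} (a : Fin (length L) → Fin k) (tops : Vector (Maybe Color) k) (t : Tokens) →
  (∀ j → Alternating (binContents L a j)) → (∀ j → Continues (tops j) (binContents L a j)) →
  (∀ c → t c ≤ #top c tops) → total (tokensFrom t L) ≤ k
tokensFrom≤bins [] {k} a tops t _ _ t≤tops = begin
  t black + t white                    ≤⟨ ℕ.+-mono-≤ (t≤tops black) (t≤tops white) ⟩
  #top black tops + #top white tops    ≡⟨ ℕΣ.∑-distrib-+ (λ j → 𝟙 (hasColour black (tops j)))
                                                          (λ j → 𝟙 (hasColour white (tops j))) ⟨
  ℕΣ.sum (λ j → 𝟙 (hasColour black (tops j)) + 𝟙 (hasColour white (tops j)))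
                                       ≤⟨ ℕΣ-≤ _ (hasColour-exclusive ∘ tops) ⟩
  k                                    ∎
  where open ℕ.≤-Reasoning
tokensFrom≤bins (x ∷ L) a tops t alternating continues t≤tops =
  tokensFrom≤bins L (a ∘ suc) tops′ (push c t) alternating′ continues′ (by-colour _ c same other)
  where
  c : Color
  c = color x

  j₀ : Fin _
  j₀ = a zero

  tops′ : Vector (Maybe Color) _
  tops′ = updateAt tops j₀ (λ _ → just c)

  alternating-j₀ : Alternating (x ∷ binContents L (a ∘ suc) j₀)
  alternating-j₀ = subst Alternating (binContents-hit x L a j₀ refl) (alternating j₀)

  alternating′ : ∀ j → Alternating (binContents L (a ∘ suc) j)
  alternating′ j with j₀ Fin.≟ j
  ... | yes refl = Alternating-tail x _ alternating-j₀
  ... | no  j₀≢j = subst Alternating (binContents-miss x L a j j₀≢j) (alternating j)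

  continues′ : ∀ j → Continues (tops′ j) (binContents L (a ∘ suc) j)
  continues′ j with j₀ Fin.≟ j
  ... | yes refl = subst (λ m → Continues m _) (sym (updateAt-updates j₀ tops)) (Alternating⇒Continues x _ alternating-j₀)
  ... | no  j₀≢j = subst₂ Continues (sym (updateAt-minimal j j₀ tops (j₀≢j ∘ sym)))
                      (binContents-miss x L a j j₀≢j) (continues j)

  top-j₀≢c : tops j₀ ≢ just c
  top-j₀≢c top≡c = subst (Continues (just c)) (binContents-hit x L a j₀ refl)
    (subst (λ m → Continues m (binContents (x ∷ L) a j₀)) top≡c (continues j₀)) refl

  same : push c t c ≤ #top c tops′
  same = subst₂ _≤_ (sym (push-same c t)) (sym (#top-set-same tops j₀ c top-j₀≢c)) (s≤s (t≤tops c))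

  other : push c t (opposite c) ≤ #top (opposite c) tops′
  other = subst (_≤ #top (opposite c) tops′) (sym (push-opposite c t))
    (ℕ.≤-trans (ℕ.∸-monoˡ-≤ 1 (t≤tops (opposite c))) (#top-set-opposite tops j₀ c))

Packable⇒tokens≤ : ∀ L k → Packable L k → total (tokens L) ≤ k
Packable⇒tokens≤ L k (a , valid) = tokensFrom≤bins L a (λ _ → nothing) (λ _ → 0) (proj₂ ∘ valid) (λ _ → tt) (λ _ → z≤n)

-- Lists of loads balanced at every threshold

atMost : ℚ → ℚ → Bool
atMost θ ℓ = isYes (ℓ ℚ.≤? θ)

beyond : ℚ → ℚ → Bool
beyond θ ℓ = isYes (1ℚ ℚ.<? ℓ ℚ.+ θ)

module _ {θ ℓ : ℚ} where

  atMost⇒≤ : T (atMost θ ℓ) → ℓ ℚ.≤ θ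
  atMost⇒≤ = toWitness {a? = ℓ ℚ.≤? θ}

  ≤⇒atMost : ℓ ℚ.≤ θ → T (atMost θ ℓ)
  ≤⇒atMost = fromWitness {a? = ℓ ℚ.≤? θ}

  beyond⇒< : T (beyond θ ℓ) → 1ℚ ℚ.< ℓ ℚ.+ θ
  beyond⇒< = toWitness {a? = 1ℚ ℚ.<? ℓ ℚ.+ θ}

  <⇒beyond : 1ℚ ℚ.< ℓ ℚ.+ θ → T (beyond θ ℓ)
  <⇒beyond = fromWitness {a? = 1ℚ ℚ.<? ℓ ℚ.+ θ}

↭-select : ∀ {A : Set} {P : A → Set} {xs} → Any P xs → ∃₂ λ y ys → xs ↭ y ∷ ys × P y
↭-select (here py) = _ , _ , ↭-refl , py
↭-select {xs = x ∷ _} (there any) with ↭-select any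
... | y , ys , xs↭ , py = y , x ∷ ys , ↭-trans (prep x xs↭) (swap x y ↭-refl) , py

↭-minimum : ∀ ℓ ls → ∃₂ λ m r → ℓ ∷ ls ↭ m ∷ r × All (m ℚ.≤_) r
↭-minimum ℓ []        = ℓ , [] , ↭-refl , []
↭-minimum ℓ (ℓ′ ∷ ls) with ↭-minimum ℓ′ ls
... | m , r , ls↭ , m≤r with ℓ ℚ.≤? m
...   | yes ℓ≤m = ℓ , m ∷ r , prep ℓ ls↭ , ℓ≤m ∷ All.map (ℚ.≤-trans ℓ≤m) m≤r
...   | no  ℓ≰m = m , ℓ ∷ r , ↭-trans (prep ℓ ls↭) (swap ℓ m ↭-refl) , ℚ.<⇒≤ (ℚ.≰⇒> ℓ≰m) ∷ m≤r

Balanced : ℕ → List ℚ → Set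
Balanced D ls = ∀ θ → θ ℚ.+ θ ℚ.≤ 1ℚ → count (atMost θ) ls ≤ D + count (beyond θ) ls

Bounded : ℕ → List ℚ → Set
Bounded D ls = fromℕ (length ls) ℚ.≤ fromℕ D ℚ.+ (sumℚ ls ℚ.+ sumℚ ls)

Balanced-↭ : ∀ {D ls ls′} → ls ↭ ls′ → Balanced D ls → Balanced D ls′
Balanced-↭ {D} ls↭ bal θ θ+θ≤1 = subst₂ (λ s l → s ≤ D + l) (count-↭ ls↭) (count-↭ ls↭) (bal θ θ+θ≤1)

Bounded-↭ : ∀ {D ls ls′} → ls ↭ ls′ → Bounded D ls → Bounded D ls′
Bounded-↭ {D} ls↭ bound = subst₂ (λ n s → fromℕ n ℚ.≤ fromℕ D ℚ.+ (s ℚ.+ s)) (↭-length ls↭) (sumℚ-↭ ls↭) bound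

Bounded-[] : ∀ D → Bounded D []
Bounded-[] D = nonneg-+ (fromℕ-nonneg D) (nonneg-+ ℚ.≤-refl ℚ.≤-refl)

Bounded-large : ∀ {D} ls → All (λ ℓ → 1ℚ ℚ.< ℓ ℚ.+ ℓ) ls → Bounded D ls
Bounded-large {D} ls large = ℚ.≤-trans (halves ls large) (≤-+-nonneg (sumℚ ls ℚ.+ sumℚ ls) (fromℕ-nonneg D))
  where
  open ℚ-Solver
  halves : ∀ ls → All (λ ℓ → 1ℚ ℚ.< ℓ ℚ.+ ℓ) ls → fromℕ (length ls) ℚ.≤ sumℚ ls ℚ.+ sumℚ ls
  halves []       []            = ℚ.≤-reflexive (sym (ℚ.+-identityʳ 0ℚ))
  halves (ℓ ∷ ls) (1<ℓ+ℓ ∷ large) = subst (fromℕ (suc (length ls)) ℚ.≤_)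
    (solve 2 (λ ℓ s → (ℓ ⊕ ℓ) ⊕ (s ⊕ s) ⊜ (ℓ ⊕ s) ⊕ (ℓ ⊕ s)) refl ℓ (sumℚ ls))
    (ℚ.+-mono-≤ (ℚ.<⇒≤ 1<ℓ+ℓ) (halves ls large))

Bounded-pair : ∀ {D x y ls} → 1ℚ ℚ.< x ℚ.+ y → Bounded D ls → Bounded D (x ∷ y ∷ ls)
Bounded-pair {D} {x} {y} {ls} 1<x+y bound = begin
  1ℚ ℚ.+ (1ℚ ℚ.+ n)                             ≡⟨ ℚ.+-assoc 1ℚ 1ℚ n ⟨
  (1ℚ ℚ.+ 1ℚ) ℚ.+ n                             ≤⟨ ℚ.+-mono-≤ (ℚ.<⇒≤ (ℚ.+-mono-< 1<x+y 1<x+y)) bound ⟩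
  ((x ℚ.+ y) ℚ.+ (x ℚ.+ y)) ℚ.+ (d ℚ.+ (s ℚ.+ s))
    ≡⟨ solve 4 (λ x y d s → ((x ⊕ y) ⊕ (x ⊕ y)) ⊕ (d ⊕ (s ⊕ s)) ⊜ d ⊕ ((x ⊕ (y ⊕ s)) ⊕ (x ⊕ (y ⊕ s)))) refl x y d s ⟩
  d ℚ.+ ((x ℚ.+ (y ℚ.+ s)) ℚ.+ (x ℚ.+ (y ℚ.+ s))) ∎
  where
  open ℚ.≤-Reasoning
  open ℚ-Solver
  n d s : ℚ
  n = fromℕ (length ls)
  d = fromℕ D
  s = sumℚ ls

Bounded-single : ∀ {D x ls} → 0ℚ ℚ.≤ x → Bounded D ls → Bounded (suc D) (x ∷ ls)
Bounded-single {D} {x} {ls} 0≤x bound = begin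
  1ℚ ℚ.+ fromℕ (length ls)                      ≤⟨ ℚ.+-monoʳ-≤ 1ℚ bound ⟩
  1ℚ ℚ.+ (fromℕ D ℚ.+ (s ℚ.+ s))                ≡⟨ ℚ.+-assoc 1ℚ (fromℕ D) (s ℚ.+ s) ⟨
  fromℕ (suc D) ℚ.+ (s ℚ.+ s)                   ≤⟨ ℚ.+-monoʳ-≤ (fromℕ (suc D))
                                                     (ℚ.+-mono-≤ (≤-+-nonneg s 0≤x) (≤-+-nonneg s 0≤x)) ⟩
  fromℕ (suc D) ℚ.+ ((x ℚ.+ s) ℚ.+ (x ℚ.+ s))   ∎
  where
  open ℚ.≤-Reasoning
  s : ℚ
  s = sumℚ ls

Balanced-drop-large : ∀ {D y ls} → (∀ θ → θ ℚ.+ θ ℚ.≤ 1ℚ → ¬ y ℚ.≤ θ) → Balanced D (y ∷ ls) → Balanced (suc D) ls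
Balanced-drop-large {D} {y} {ls} y-large bal θ θ+θ≤1 = begin
  count (atMost θ) ls                                   ≡⟨ cong (_+ count (atMost θ) ls) (𝟙-¬T (y-large θ θ+θ≤1 ∘ atMost⇒≤)) ⟨
  𝟙 (atMost θ y) + count (atMost θ) ls                  ≤⟨ bal θ θ+θ≤1 ⟩
  D + (𝟙 (beyond θ y) + count (beyond θ) ls)            ≤⟨ ℕ.+-monoʳ-≤ D
                                                             (ℕ.+-monoˡ-≤ (count (beyond θ) ls) (𝟙≤1 (beyond θ y))) ⟩
  D + suc (count (beyond θ) ls)                         ≡⟨ ℕ.+-suc D _ ⟩
  suc D + count (beyond θ) ls                           ∎
  where open ℕ.≤-Reasoning

-- For θ ≥ m the minimum is small and, being at most 1/2, not large; for θ < m nothing is small.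
Balanced-drop-min : ∀ {D m ls} → All (m ℚ.≤_) ls → m ℚ.+ m ℚ.≤ 1ℚ → Balanced D (m ∷ ls) → Balanced (D ∸ 1) ls
Balanced-drop-min {D} {m} {ls} m≤ls m+m≤1 bal θ θ+θ≤1 with m ℚ.≤? θ
... | yes m≤θ = suc≤+⇒≤∸1+ D (count (beyond θ) ls) (subst₂ (λ a l → a ≤ D + l)
      (cong (_+ count (atMost θ) ls) (𝟙-T (≤⇒atMost m≤θ)))
      (cong (_+ count (beyond θ) ls) (𝟙-¬T (λ m-beyond → <⇒≱ (beyond⇒< {θ} {m} m-beyond) (doubles≤1⇒+≤1 m θ m+m≤1 θ+θ≤1))))
      (bal θ θ+θ≤1))
... | no  m≰θ = subst (_≤ (D ∸ 1) + count (beyond θ) ls)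
      (sym (count-zero (atMost θ) (All.map (λ m≤y y≤θ → m≰θ (ℚ.≤-trans m≤y (atMost⇒≤ y≤θ))) m≤ls))) z≤n

Balanced-drop-pair : ∀ {D m y ls} → All (m ℚ.≤_) ls → m ℚ.+ m ℚ.≤ 1ℚ → ¬ m ℚ.+ y ℚ.≤ 1ℚ →
                     Balanced D (m ∷ y ∷ ls) → Balanced D ls
Balanced-drop-pair {D} {m} {y} {ls} m≤ls m+m≤1 m+y≰1 bal =
  Balanced-drop-min {suc D} m≤ls m+m≤1 (Balanced-drop-large {D} {y} {m ∷ ls} y-large
    (Balanced-↭ {D} {m ∷ y ∷ ls} {y ∷ m ∷ ls} (swap m y ↭-refl) bal))
  where
  y-large : ∀ θ → θ ℚ.+ θ ℚ.≤ 1ℚ → ¬ y ℚ.≤ θ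
  y-large θ θ+θ≤1 y≤θ = m+y≰1 (ℚ.≤-trans (ℚ.+-monoʳ-≤ m y≤θ) (doubles≤1⇒+≤1 m θ m+m≤1 θ+θ≤1))

-- Test at θ = m: the minimum is small but nothing is large.
Balanced-positive : ∀ {D m ls} → m ℚ.+ m ℚ.≤ 1ℚ → All (λ y → m ℚ.+ y ℚ.≤ 1ℚ) ls → Balanced D (m ∷ ls) → 1 ≤ D
Balanced-positive {D} {m} {ls} m+m≤1 no-partner bal = subst (1 ≤_) (ℕ.+-identityʳ D) (begin
  1                                            ≤⟨ ℕ.m≤m+n 1 (count (atMost m) ls) ⟩
  1 + count (atMost m) ls                      ≡⟨ cong (_+ count (atMost m) ls) (𝟙-T (≤⇒atMost ℚ.≤-refl)) ⟨
  count (atMost m) (m ∷ ls)                    ≤⟨ bal m m+m≤1 ⟩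
  D + count (beyond m) (m ∷ ls)                ≡⟨ cong (D +_) (count-zero (beyond m) {m ∷ ls}
                                                    (not-large {m} m+m≤1 ∷ All.map (λ {y} → not-large′ {y}) no-partner)) ⟩
  D + 0                                        ∎)
  where
  open ℕ.≤-Reasoning
  not-large : ∀ {y} → y ℚ.+ m ℚ.≤ 1ℚ → ¬ T (beyond m y)
  not-large {y} y+m≤1 y-large = <⇒≱ (beyond⇒< {m} {y} y-large) y+m≤1
  not-large′ : ∀ {y} → m ℚ.+ y ℚ.≤ 1ℚ → ¬ T (beyond m y)
  not-large′ {y} m+y≤1 = not-large {y} (subst (ℚ._≤ 1ℚ) (ℚ.+-comm m y) m+y≤1)

bounded-at-minimum : ∀ {D m r} →
  (∀ {D′} ls → length ls < suc (length r) → All (0ℚ ℚ.≤_) ls → Balanced D′ ls → Bounded D′ ls) →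
  All (m ℚ.≤_) r → All (0ℚ ℚ.≤_) (m ∷ r) → Balanced D (m ∷ r) → Bounded D (m ∷ r)
bounded-at-minimum {D} {m} {r} ih m≤r (0≤m ∷ nonneg) bal with (m ℚ.+ m) ℚ.≤? 1ℚ
... | no m+m≰1 = Bounded-large {D} (m ∷ r)
      (ℚ.≰⇒> m+m≰1 ∷ All.map (λ m≤y → ℚ.<-≤-trans (ℚ.≰⇒> m+m≰1) (ℚ.+-mono-≤ m≤y m≤y)) m≤r)
... | yes m+m≤1 with all? (λ y → (m ℚ.+ y) ℚ.≤? 1ℚ) r
...   | yes no-partner = subst (λ D → Bounded D (m ∷ r)) (ℕ.m+[n∸m]≡n {1} {D} (Balanced-positive {D} m+m≤1 no-partner bal))
      (Bounded-single {D ∸ 1} {m} {r} 0≤m (ih {D ∸ 1} r ℕ.≤-refl nonneg (Balanced-drop-min {D} m≤r m+m≤1 bal)))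
...   | no  has-partner with ↭-select (¬All⇒Any¬ (λ y → (m ℚ.+ y) ℚ.≤? 1ℚ) r has-partner)
...     | y , r′ , r↭ , m+y≰1 = Bounded-↭ {D} (prep m (↭-sym r↭)) (Bounded-pair {D} {m} {y} {r′} (ℚ.≰⇒> m+y≰1)
      (ih {D} r′ (subst (λ n → length r′ < suc n) (sym (↭-length r↭)) (ℕ.m≤n⇒m≤1+n ℕ.≤-refl))
        (All.tail (All-resp-↭ r↭ nonneg))
        (Balanced-drop-pair {D} (All.tail (All-resp-↭ r↭ m≤r)) m+m≤1 m+y≰1 (Balanced-↭ {D} (prep m r↭) bal))))

Balanced⇒Bounded : ∀ {D} ls → All (0ℚ ℚ.≤_) ls → Balanced D ls → Bounded D ls
Balanced⇒Bounded ls = go ls (<-wellFounded (length ls))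
  where
  go : ∀ {D} ls → Acc _<_ (length ls) → All (0ℚ ℚ.≤_) ls → Balanced D ls → Bounded D ls
  go {D} []       _         _      _   = Bounded-[] D
  go {D}  (ℓ ∷ ls) (acc rec) nonneg bal with ↭-minimum ℓ ls
  ... | m , r , ls↭ , m≤r = Bounded-↭ {D} (↭-sym ls↭) (bounded-at-minimum {D} {m} {r}
        (λ {D′} ls′ shorter → go {D′} ls′ (rec (subst (length ls′ <_) (sym (↭-length ls↭)) shorter)))
        m≤r (All-resp-↭ ls↭ nonneg) (Balanced-↭ {D} ls↭ bal))

-- Invariants of Any Fit runs

lookup-↭ : ∀ {A : Set} (xs : List A) i → xs ↭ lookup xs i ∷ removeAt xs i
lookup-↭ (x ∷ xs) zero    = ↭-refl
lookup-↭ (x ∷ xs) (suc i) = ↭-trans (prep x (lookup-↭ xs i)) (swap x _ ↭-refl)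

addTo-↭ : ∀ bs i x → addTo bs i x ↭ (lookup bs i ++ [ x ]) ∷ removeAt bs i
addTo-↭ (b ∷ bs) zero    x = ↭-refl
addTo-↭ (b ∷ bs) (suc i) x = ↭-trans (prep b (addTo-↭ bs i x)) (swap b _ ↭-refl)

-- The invariants below do not depend on the order of the bins, so each step can be analysed
-- with the bin that changes moved to the front.
record AnyFitInvariant (P : List Item → List Bin → Set) : Set where
  field
    respects-↭ : ∀ {h bs bs′} → bs ↭ bs′ → P h bs → P h bs′
    fit : ∀ {h b bs x} → InUnit x → Fits b x → P h (b ∷ bs) → P (h ++ [ x ]) ((b ++ [ x ]) ∷ bs)
    new : ∀ {h bs x} → InUnit x → All (λ b → ¬ Fits b x) bs → P h bs → P (h ++ [ x ]) ([ x ] ∷ bs)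

module _ {P : List Item → List Bin → Set} (inv : AnyFitInvariant P) (A : AnyFit) where
  open AnyFitInvariant inv

  runFrom-invariant : ∀ h bs xs → All InUnit xs → P h bs → P (h ++ xs) (runFrom A h bs xs)
  runFrom-invariant h bs []       []         p = subst (λ h′ → P h′ bs) (sym (++-identityʳ h)) p
  runFrom-invariant h bs (x ∷ xs) (ux ∷ uxs) p =
    subst (λ h′ → P h′ (runFrom A h bs (x ∷ xs))) (++-assoc h [ x ] xs)
      (runFrom-invariant (h ++ [ x ]) _ xs uxs (step _ refl))
    where
    step : ∀ choice → choose A h bs x ≡ choice → P (h ++ [ x ]) (place bs choice x)
    step (just i) chose = respects-↭ (↭-sym (addTo-↭ bs i x))
      (fit ux (sound A h bs x i chose) (respects-↭ (lookup-↭ bs i) p))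
    step nothing  chose = respects-↭ (∷↭∷ʳ [ x ] bs)
      (new ux (subst (All _) (tabulate-lookup bs) (tabulate⁺ (complete A h bs x chose))) p)

  run-invariant : ∀ L → All InUnit L → P [] [] → P L (run A L)
  run-invariant = runFrom-invariant [] []

load-∷ʳ : ∀ b x → load (b ++ [ x ]) ≡ load b ℚ.+ size x
load-∷ʳ []      x = ℚ.+-comm (size x) 0ℚ
load-∷ʳ (y ∷ b) x = trans (cong (size y ℚ.+_) (load-∷ʳ b x)) (sym (ℚ.+-assoc (size y) (load b) (size x)))

load-≤-∷ʳ : ∀ b {x} → InUnit x → load b ℚ.≤ load (b ++ [ x ])
load-≤-∷ʳ b {x} (0≤x , _) =
  subst (load b ℚ.≤_) (sym (trans (load-∷ʳ b x) (ℚ.+-comm (load b) (size x)))) (≤-+-nonneg (load b) 0≤x)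

total-load : AnyFitInvariant (λ h bs → sumℚ (map load bs) ≡ load h)
total-load = record
  { respects-↭ = λ bs↭ total≡ → trans (sym (sumℚ-↭ (map⁺ load bs↭))) total≡
  ; fit        = λ {h} {b} {bs} {x} → fit {h} {b} {bs} {x}
  ; new        = λ {h} {bs} {x} → new {h} {bs} {x}
  }
  where
  open ℚ-Solver
  fit : ∀ {h b bs x} → InUnit x → Fits b x → sumℚ (map load (b ∷ bs)) ≡ load h →
        sumℚ (map load ((b ++ [ x ]) ∷ bs)) ≡ load (h ++ [ x ])
  fit {h} {b} {bs} {x} _ _ total≡ = begin
    load (b ++ [ x ]) ℚ.+ sumℚ (map load bs)      ≡⟨ cong (ℚ._+ sumℚ (map load bs)) (load-∷ʳ b x) ⟩
    (load b ℚ.+ size x) ℚ.+ sumℚ (map load bs)    ≡⟨ solve 3 (λ a s r → (a ⊕ s) ⊕ r ⊜ (a ⊕ r) ⊕ s) refl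
                                                       (load b) (size x) (sumℚ (map load bs)) ⟩
    (load b ℚ.+ sumℚ (map load bs)) ℚ.+ size x    ≡⟨ cong (ℚ._+ size x) total≡ ⟩
    load h ℚ.+ size x                             ≡⟨ load-∷ʳ h x ⟨
    load (h ++ [ x ])                             ∎
    where open ≡-Reasoning
  new : ∀ {h bs x} → InUnit x → All (λ b → ¬ Fits b x) bs → sumℚ (map load bs) ≡ load h →
        sumℚ (map load ([ x ] ∷ bs)) ≡ load (h ++ [ x ])
  new {h} {bs} {x} _ _ total≡ = begin
    (size x ℚ.+ 0ℚ) ℚ.+ sumℚ (map load bs)        ≡⟨ solve 2 (λ s r → (s ⊕ id) ⊕ r ⊜ r ⊕ s) refl
                                                       (size x) (sumℚ (map load bs)) ⟩
    sumℚ (map load bs) ℚ.+ size x                 ≡⟨ cong (ℚ._+ size x) total≡ ⟩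
    load h ℚ.+ size x                             ≡⟨ load-∷ʳ h x ⟨
    load (h ++ [ x ])                             ∎
    where open ≡-Reasoning

Occupied : Bin → Set
Occupied b = b ≢ [] × 0ℚ ℚ.≤ load b

∷ʳ≢[] : ∀ (b : Bin) x → b ++ [ x ] ≢ []
∷ʳ≢[] []      x ()
∷ʳ≢[] (_ ∷ _) x ()

occupied : AnyFitInvariant (λ _ bs → All Occupied bs)
occupied = record { respects-↭ = All-resp-↭ ; fit = λ {h} → fit {h} ; new = λ {h} → new {h} }
  where
  fit : ∀ {h b bs x} → InUnit x → Fits b x → All Occupied (b ∷ bs) → All Occupied ((b ++ [ x ]) ∷ bs)
  fit {b = b} {x = x} x∈[0,1] _ ((_ , 0≤b) ∷ bs-occ) =
    (∷ʳ≢[] b x , ℚ.≤-trans 0≤b (load-≤-∷ʳ b x∈[0,1])) ∷ bs-occ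
  new : ∀ {h bs x} → InUnit x → All (λ b → ¬ Fits b x) bs → All Occupied bs → All Occupied ([ x ] ∷ bs)
  new (0≤x , _) _ bs-occ = ((λ ()) , nonneg-+ 0≤x ℚ.≤-refl) ∷ bs-occ

countTop : Color → (Bin → Bool) → List Bin → ℕ
countTop c q = count (λ b → isTop c b ∧ q b)

countTop-top : ∀ c q b bs → T (isTop c b) → countTop c q (b ∷ bs) ≡ 𝟙 (q b) + countTop c q bs
countTop-top c _ b _ c∈b with isTop c b
... | true = refl

countTop-other : ∀ c q b bs → ¬ T (isTop c b) → countTop c q (b ∷ bs) ≡ countTop c q bs
countTop-other c _ b _ c∉b with isTop c b
... | true  = ⊥-elim (c∉b tt)
... | false = refl

module Threshold (θ : ℚ) where

  small large : Bin → Bool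
  small = atMost θ ∘ load
  large = beyond θ ∘ load

  #small #nonSmall : Color → List Bin → ℕ
  #small c    = countTop c small
  #nonSmall c = countTop c (not ∘ small)

  -- colourwise is only needed to restore overall when a small item opens a bin: every bin
  -- topped by the other colour then overflows, hence is large.
  record Invariant (t : Tokens) (bs : List Bin) : Set where
    field
      colourwise : ∀ c → #small c bs ≤ t c + #nonSmall (opposite c) bs
      overall    : count small bs ≤ total t + count large bs
  open Invariant public

  module _ {t : Tokens} {bs : List Bin} where

    colourwise-opposite : Invariant t bs → ∀ c → #small (opposite c) bs ≤ t (opposite c) + #nonSmall c bs
    colourwise-opposite I c = subst (λ d → #small (opposite c) bs ≤ t (opposite c) + #nonSmall d bs)
      (opposite-involutive c) (colourwise I (opposite c))

    colourwise-by : ∀ c → #small c bs ≤ t c + #nonSmall (opposite c) bs →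
                    #small (opposite c) bs ≤ t (opposite c) + #nonSmall c bs →
                    ∀ d → #small d bs ≤ t d + #nonSmall (opposite d) bs
    colourwise-by c same other = by-colour _ c same
      (subst (λ d → #small (opposite c) bs ≤ t (opposite c) + #nonSmall d bs) (sym (opposite-involutive c)) other)

  Invariant-[] : ∀ {t} → Invariant t []
  Invariant-[] = record { colourwise = λ _ → z≤n ; overall = z≤n }

  Invariant-↭ : ∀ {t bs bs′} → bs ↭ bs′ → Invariant t bs → Invariant t bs′
  Invariant-↭ {t} bs↭ I = record
    { colourwise = λ c → subst₂ (λ s n → s ≤ t c + n) (count-↭ bs↭) (count-↭ bs↭) (colourwise I c)
    ; overall    = subst₂ (λ s l → s ≤ total t + l) (count-↭ bs↭) (count-↭ bs↭) (overall I)
    }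

  module Move {c : Color} {t : Tokens} {b b′ : Bin} {bs : List Bin}
              (top-b : top b ≡ just (opposite c)) (top-b′ : top b′ ≡ just c) (b≤b′ : load b ℚ.≤ load b′)
              (I : Invariant t (b ∷ bs)) where
    open ℕ.≤-Reasoning

    o : Color
    o = opposite c

    c∉b : ¬ T (isTop c b)
    c∉b = isTop-≢ b top-b (opposite-≢ c)

    o∈b : T (isTop o b)
    o∈b = isTop-just b top-b

    c∈b′ : T (isTop c b′)
    c∈b′ = isTop-just b′ top-b′

    o∉b′ : ¬ T (isTop o b′)
    o∉b′ = isTop-≢ b′ top-b′ (opposite-≢ c ∘ sym)

    small-anti : T (small b′) → T (small b)
    small-anti = ≤⇒atMost ∘ ℚ.≤-trans b≤b′ ∘ atMost⇒≤ {θ} {load b′}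

    large-mono : T (large b) → T (large b′)
    large-mono = <⇒beyond {θ} {load b′} ∘ (λ 1<b → ℚ.<-≤-trans 1<b (ℚ.+-monoˡ-≤ θ b≤b′)) ∘ beyond⇒< {θ} {load b}

    same : #small c (b′ ∷ bs) ≤ push c t c + #nonSmall o (b′ ∷ bs)
    same = begin
      #small c (b′ ∷ bs)                                ≡⟨ countTop-top c small b′ bs c∈b′ ⟩
      𝟙 (small b′) + #small c bs                        ≡⟨ cong (𝟙 (small b′) +_) (countTop-other c small b bs c∉b) ⟨
      𝟙 (small b′) + #small c (b ∷ bs)                  ≤⟨ ℕ.+-monoʳ-≤ (𝟙 (small b′)) (colourwise I c) ⟩
      𝟙 (small b′) + (t c + #nonSmall o (b ∷ bs))       ≡⟨ cong (λ n → 𝟙 (small b′) + (t c + n))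
                                                             (countTop-top o (not ∘ small) b bs o∈b) ⟩
      𝟙 (small b′) + (t c + (𝟙 (not (small b)) + #nonSmall o bs))
        ≡⟨ solve 4 (λ s t n u → s ⊕ (t ⊕ (n ⊕ u)) ⊜ (n ⊕ s) ⊕ (t ⊕ u)) refl
             (𝟙 (small b′)) (t c) (𝟙 (not (small b))) (#nonSmall o bs) ⟩
      (𝟙 (not (small b)) + 𝟙 (small b′)) + (t c + #nonSmall o bs)
        ≤⟨ ℕ.+-monoˡ-≤ (t c + #nonSmall o bs) (𝟙-not+𝟙 small-anti) ⟩
      suc (t c + #nonSmall o bs)                        ≡⟨ cong₂ _+_ (push-same c t)
                                                             (countTop-other o (not ∘ small) b′ bs o∉b′) ⟨
      push c t c + #nonSmall o (b′ ∷ bs)                ∎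
      where open CommutativeMonoidSolver ℕ.+-0-commutativeMonoid

    -- Either b was small, and #small o drops together with the token, or b′ is not small
    -- and counts on the right-hand side instead.
    spend : ∀ p q {a} n u → (T q → T p) → 𝟙 p + a ≤ n + u → a ≤ (n ∸ 1) + (𝟙 (not q) + u)
    spend true  q     n u _   a<n+u = ℕ.≤-trans (suc≤+⇒≤∸1+ n u a<n+u) (ℕ.+-monoʳ-≤ (n ∸ 1) (ℕ.m≤n+m u (𝟙 (not q))))
    spend false false n u _   a≤n+u = ℕ.≤-trans a≤n+u (+≤∸1+suc n u)
    spend false true  n u q⇒p _     = ⊥-elim (q⇒p tt)

    other : #small o (b′ ∷ bs) ≤ push c t o + #nonSmall c (b′ ∷ bs)
    other = begin
      #small o (b′ ∷ bs)                                 ≡⟨ countTop-other o small b′ bs o∉b′ ⟩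
      #small o bs                                        ≤⟨ spend (small b) (small b′) (t o) (#nonSmall c bs)
                                                              small-anti before ⟩
      (t o ∸ 1) + (𝟙 (not (small b′)) + #nonSmall c bs)  ≡⟨ cong₂ _+_ (push-opposite c t)
                                                              (countTop-top c (not ∘ small) b′ bs c∈b′) ⟨
      push c t o + #nonSmall c (b′ ∷ bs)                 ∎
      where
      before : 𝟙 (small b) + #small o bs ≤ t o + #nonSmall c bs
      before = subst₂ (λ s n → s ≤ t o + n) (countTop-top o small b bs o∈b)
        (countTop-other c (not ∘ small) b bs c∉b) (colourwise-opposite I c)

    overall′ : count small (b′ ∷ bs) ≤ total (push c t) + count large (b′ ∷ bs)
    overall′ = begin
      count small (b′ ∷ bs)                     ≤⟨ ℕ.+-monoˡ-≤ (count small bs) (𝟙-mono small-anti) ⟩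
      count small (b ∷ bs)                      ≤⟨ overall I ⟩
      total t + count large (b ∷ bs)            ≤⟨ ℕ.+-mono-≤ (total≤total-push c t)
                                                     (ℕ.+-monoˡ-≤ (count large bs) (𝟙-mono large-mono)) ⟩
      total (push c t) + count large (b′ ∷ bs)  ∎

  Invariant-move : ∀ {c t b b′ bs} → top b ≡ just (opposite c) → top b′ ≡ just c → load b ℚ.≤ load b′ →
                   Invariant t (b ∷ bs) → Invariant (push c t) (b′ ∷ bs)
  Invariant-move {c} {t} {b} {b′} {bs} top-b top-b′ b≤b′ I = record
    { colourwise = colourwise-by {push c t} {b′ ∷ bs} c same other
    ; overall    = overall′
    }
    where open Move {c} {t} {b} {b′} {bs} top-b top-b′ b≤b′ I

  module NewBin (θ+θ≤1 : θ ℚ.+ θ ℚ.≤ 1ℚ) {t : Tokens} {bs : List Bin} {x : Item}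
                (rejects : All (λ b → ¬ Fits b x) bs) (I : Invariant t bs) where
    open ℕ.≤-Reasoning

    c o : Color
    c = color x
    o = opposite c

    c∈x : T (isTop c [ x ])
    c∈x = hasColour-just c

    o∉x : ¬ T (isTop o [ x ])
    o∉x = hasColour-≢ (opposite-≢ c ∘ sym ∘ just-injective)

    size≤θ : T (small [ x ]) → size x ℚ.≤ θ
    size≤θ x-small = subst (ℚ._≤ θ) (ℚ.+-identityʳ (size x)) (atMost⇒≤ {θ} {load [ x ]} x-small)

    rejecter-top : T (small [ x ]) → ∀ b → ¬ Fits b x → T (small b) → top b ≡ just c
    rejecter-top x-small b ¬fits b-small = ¬ColourOK⇒top b x λ ok →
      ¬fits (ℚ.≤-trans (ℚ.+-mono-≤ (atMost⇒≤ {θ} {load b} b-small) (size≤θ x-small)) θ+θ≤1 , ok)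

    rejecter-large : T (small [ x ]) → ∀ b → ¬ Fits b x → top b ≢ just c → T (large b)
    rejecter-large x-small b ¬fits top≢ = <⇒beyond {θ} {load b}
      (ℚ.<-≤-trans (ℚ.≰⇒> λ fits → ¬fits (fits , top≢⇒ColourOK b x top≢))
                   (ℚ.+-monoʳ-≤ (load b) (size≤θ x-small)))

    no-small-o : T (small [ x ]) → #small o bs ≡ 0
    no-small-o x-small = count-zero (λ b → isTop o b ∧ small b) (All.map (λ {b} ¬fits o-small →
      let o∈b , b-small = Equivalence.to (T-∧ {isTop o b} {small b}) o-small
      in isTop-≢ b (rejecter-top x-small b ¬fits b-small) (opposite-≢ c ∘ sym) o∈b) rejects)

    small⇒topped : T (small [ x ]) → count small bs ≤ #small c bs
    small⇒topped x-small = count-mono small (λ b → isTop c b ∧ small b) (All.map (λ {b} ¬fits b-small →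
      Equivalence.from (T-∧ {isTop c b} {small b}) (isTop-just b (rejecter-top x-small b ¬fits b-small) , b-small)) rejects)

    nonSmall⇒large : T (small [ x ]) → #nonSmall o bs ≤ count large bs
    nonSmall⇒large x-small = count-mono (λ b → isTop o b ∧ not (small b)) large (All.map (λ {b} ¬fits o-nonSmall →
      rejecter-large x-small b ¬fits λ top≡c →
        isTop-≢ b top≡c (opposite-≢ c ∘ sym) (proj₁ (Equivalence.to (T-∧ {isTop o b} {not (small b)}) o-nonSmall))) rejects)

    same : #small c ([ x ] ∷ bs) ≤ push c t c + #nonSmall o ([ x ] ∷ bs)
    same = begin
      #small c ([ x ] ∷ bs)                   ≡⟨ countTop-top c small [ x ] bs c∈x ⟩
      𝟙 (small [ x ]) + #small c bs           ≤⟨ ℕ.+-mono-≤ (𝟙≤1 (small [ x ])) (colourwise I c) ⟩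
      suc (t c + #nonSmall o bs)              ≡⟨ cong₂ _+_ (push-same c t) (countTop-other o (not ∘ small) [ x ] bs o∉x) ⟨
      push c t c + #nonSmall o ([ x ] ∷ bs)   ∎

    other : #small o ([ x ] ∷ bs) ≤ push c t o + #nonSmall c ([ x ] ∷ bs)
    other = begin
      #small o ([ x ] ∷ bs)                                 ≡⟨ countTop-other o small [ x ] bs o∉x ⟩
      #small o bs                                           ≤⟨ by-size (small [ x ]) no-small-o (colourwise-opposite I c) ⟩
      (t o ∸ 1) + (𝟙 (not (small [ x ])) + #nonSmall c bs)  ≡⟨ cong₂ _+_ (push-opposite c t)
                                                                 (countTop-top c (not ∘ small) [ x ] bs c∈x) ⟨
      push c t o + #nonSmall c ([ x ] ∷ bs)                 ∎
      where
      by-size : ∀ p → (T p → #small o bs ≡ 0) → #small o bs ≤ t o + #nonSmall c bs →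
                #small o bs ≤ (t o ∸ 1) + (𝟙 (not p) + #nonSmall c bs)
      by-size true  none _ = ℕ.≤-trans (ℕ.≤-reflexive (none tt)) z≤n
      by-size false _    h = ℕ.≤-trans h (+≤∸1+suc (t o) (#nonSmall c bs))

    overall′ : count small ([ x ] ∷ bs) ≤ total (push c t) + count large ([ x ] ∷ bs)
    overall′ = ℕ.≤-trans (by-size (small [ x ]) refl)
      (ℕ.+-monoʳ-≤ (total (push c t)) (ℕ.m≤n+m (count large bs) (𝟙 (large [ x ]))))
      where
      by-size : ∀ p → small [ x ] ≡ p → 𝟙 p + count small bs ≤ total (push c t) + count large bs
      by-size false _ = ℕ.≤-trans (overall I) (ℕ.+-monoˡ-≤ (count large bs) (total≤total-push c t))
      by-size true  x-small = begin
        suc (count small bs)               ≤⟨ s≤s (small⇒topped (subst T (sym x-small) tt)) ⟩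
        suc (#small c bs)                  ≤⟨ s≤s (colourwise I c) ⟩
        suc (t c) + #nonSmall o bs         ≤⟨ ℕ.+-mono-≤ (suc≤total-push c t) (nonSmall⇒large (subst T (sym x-small) tt)) ⟩
        total (push c t) + count large bs  ∎

  Invariant-new : θ ℚ.+ θ ℚ.≤ 1ℚ → ∀ {t bs x} → All (λ b → ¬ Fits b x) bs →
                  Invariant t bs → Invariant (push (color x) t) ([ x ] ∷ bs)
  Invariant-new θ+θ≤1 {t} {bs} {x} rejects I = record
    { colourwise = colourwise-by {push (color x) t} {[ x ] ∷ bs} (color x) same other
    ; overall    = overall′
    }
    where open NewBin θ+θ≤1 {t} {bs} {x} rejects I

  threshold-invariant : θ ℚ.+ θ ℚ.≤ 1ℚ → AnyFitInvariant (λ h bs → All Occupied bs × Invariant (tokens h) bs)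
  threshold-invariant θ+θ≤1 = record
    { respects-↭ = λ bs↭ (occ , I) → All-resp-↭ bs↭ occ , Invariant-↭ bs↭ I
    ; fit        = λ {h} {b} {bs} {x} x∈[0,1] fits (occ , I) →
        AnyFitInvariant.fit occupied {h} x∈[0,1] fits occ ,
        subst (λ t → Invariant t ((b ++ [ x ]) ∷ bs)) (sym (tokens-∷ʳ h x))
          (Invariant-move {color x} {tokens h} {b} {b ++ [ x ]} {bs}
            (ColourOK⇒top b x (proj₁ (All.head occ)) (proj₂ fits)) (top-∷ʳ b x) (load-≤-∷ʳ b x∈[0,1]) I)
    ; new        = λ {h} {bs} {x} x∈[0,1] rejects (occ , I) →
        AnyFitInvariant.new occupied {h} x∈[0,1] rejects occ ,
        subst (λ t → Invariant t ([ x ] ∷ bs)) (sym (tokens-∷ʳ h x)) (Invariant-new θ+θ≤1 rejects I)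
    }

run-load : ∀ A L → All InUnit L → sumℚ (map load (run A L)) ≡ load L
run-load A L items = run-invariant total-load A L items refl

length-run≤ : ∀ A L → All InUnit L →
  fromℕ (length (run A L)) ℚ.≤ fromℕ (total (tokens L)) ℚ.+ (load L ℚ.+ load L)
length-run≤ A L items = subst₂ (λ n s → fromℕ n ℚ.≤ fromℕ D ℚ.+ (s ℚ.+ s))
  (length-map load bins) (run-load A L items) (Balanced⇒Bounded {D} (map load bins) nonneg balanced)
  where
  bins : List Bin
  bins = run A L

  D : ℕ
  D = total (tokens L)

  nonneg : All (0ℚ ℚ.≤_) (map load bins)
  nonneg = All-map⁺ (All.map proj₂ (run-invariant occupied A L items []))

  balanced : Balanced D (map load bins)
  balanced θ θ+θ≤1 = subst₂ (λ s l → s ≤ D + l)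
    (sym (count-map (atMost θ) load bins)) (sym (count-map (beyond θ) load bins))
    (overall (proj₂ (run-invariant (threshold-invariant θ+θ≤1) A L items ([] , Invariant-[]))))
    where open Threshold θ

theorem5p1 : (A : AnyFit) (L : List Item) → All InUnit L →
    (k : ℕ) → Packable L k → length (run A L) ≤ 3 * k
theorem5p1 A L items k packing = fromℕ-cancel-≤ (begin
  fromℕ (length (run A L))                          ≤⟨ length-run≤ A L items ⟩
  fromℕ (total (tokens L)) ℚ.+ (load L ℚ.+ load L)  ≤⟨ ℚ.+-mono-≤ (fromℕ-mono-≤ (Packable⇒tokens≤ L k packing))
                                                                   (ℚ.+-mono-≤ load≤k load≤k) ⟩
  fromℕ k ℚ.+ (fromℕ k ℚ.+ fromℕ k)                 ≡⟨ fromℕ-3* k ⟩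
  fromℕ (3 * k)                                     ∎)
  where
  open ℚ.≤-Reasoning
  load≤k : load L ℚ.≤ fromℕ k
  load≤k = Packable⇒load≤ L k packing
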